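{- For $n\geq 2$, the number of permutations $\pi\in\mathcal{S}_n$ such that $\pi^2$ has exactly one descent is at least \[(n-1)\sum_{i=1}^{\lfloor\frac{n-1}{2}\rfloor} e_{n-(2i+1)},\] where $e_j$ denotes the number of involutions in $\mathcal{S}_j$ (with $e_0=1$).
   Context: $\mathcal{S}_n$ is the symmetric group on $[n]$; a permutation $\sigma=\sigma_1\cdots\sigma_n$ (one-line notation) has a descent at position $i\in[n-1]$ if $\sigma_i>\sigma_{i+1}$. $\pi^2(i)=\pi(\pi(i))$. An involution is a permutation $\tau$ with $\tau^2$ the identity. -}

module Defs where

open import Data.Nat using (ℕ; zero; suc; _+_; _∸_; _*_; _/_; _<ᵇ_)
open import Data.Fin using (Fin; zero; suc; toℕ; inject₁; _≟_)
open import Data.List using (List; []; _∷_; map; concatMap; length; filter; allFin; sum; upTo; applyUpTo)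
open import Data.Bool using (Bool; true; false; if_then_else_)
open import Relation.Nullary using (Dec; yes; no; ¬_)
open import Relation.Nullary.Decidable using (⌊_⌋)
open import Relation.Binary.PropositionalEquality using (_≡_)

allFuns : (n m : ℕ) → List (Fin n → Fin m)
allFuns zero    m = (λ ()) ∷ []
allFuns (suc n) m =
  concatMap (λ (a : Fin m) → map (λ (f : Fin n → Fin m) → λ { zero → a ; (suc i) → f i }) (allFuns n m)) (allFin m)

allB : {n : ℕ} → (Fin n → Bool) → Bool
allB {n} p = allL (allFin n)
  where
  allL : List (Fin n) → Bool
  allL []       = true
  allL (x ∷ xs) = p x Data.Bool.∧ allL xs

countB : {A : Set} → (A → Bool) → List A → ℕ
countB p []       = 0
countB p (x ∷ xs) = (if p x then 1 else 0) + countB p xs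

-- f is injective (for f : Fin n → Fin n this means f is a permutation of [n])
isInjectiveB : {n : ℕ} → (Fin n → Fin n) → Bool
isInjectiveB {n} f = allB λ i → allB λ j → if ⌊ f i ≟ f j ⌋ then ⌊ i ≟ j ⌋ else true

isInvolutionB : {n : ℕ} → (Fin n → Fin n) → Bool
isInvolutionB {n} f = allB λ i → ⌊ f (f i) ≟ i ⌋

-- number of descents of σ in one-line notation: positions i ∈ [n-1] with σ(i) > σ(i+1)
-- (positions are 0-indexed here: i and i+1 as elements of Fin (suc n))
descents : {n : ℕ} → (Fin n → Fin n) → ℕ
descents {zero}  σ = 0
descents {suc n} σ =
  length (filter (λ (i : Fin n) → toℕ (σ (suc i)) Data.Nat.<? toℕ (σ (inject₁ i))) (allFin n))

e : ℕ → ℕ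
e j = countB isInvolutionB (allFuns j j)

countOneDescentSquares : ℕ → ℕ
countOneDescentSquares n =
  countB
    (λ π → isInjectiveB π Data.Bool.∧ ⌊ descents (λ i → π (π i)) Data.Nat.≟ 1 ⌋)
    (allFuns n n)

sumFrom1 : ℕ → (ℕ → ℕ) → ℕ
sumFrom1 zero    f = 0
sumFrom1 (suc k) f = sumFrom1 k f + f (suc k)

{-# OPTIONS --safe #-}
-- Fix an odd block length s = 2i + 1 ≤ n, a start a ≤ n − s, a shift 0 < t < s and an
-- involution τ of n − s points. The permutation π that rotates the block [a, a + s) by t and
-- acts as τ on the other points has π² equal to the identity off the block and to a rotation
-- by 2t mod s ≠ 0 on it (s is odd), so π² has exactly one descent. The data are recovered
-- from π: the block is the set of points moved by π², t = π(a) − a, and τ is π off the block.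
-- So for each i there are (n − s + 1)(s − 1) e_{n−s} ≥ (n − 1) e_{n−s} distinct such π.
module Submission where

open import Defs
open import Data.Bool using (Bool; true; false; T; _∧_; if_then_else_)
open import Data.Bool.ListAction using (all)
open import Data.Bool.Properties using (T-∧)
open import Data.Empty using (⊥-elim)
open import Data.Fin as F using (Fin; zero; suc; toℕ; fromℕ<; inject₁)
open import Data.Fin.Properties using (toℕ-fromℕ<; fromℕ<-toℕ; toℕ<n; toℕ-injective; toℕ-inject₁; injective⇒≤)
open import Data.List using (List; []; _∷_; map; concatMap; length; filter; allFin; lookup; applyUpTo; upTo; _++_; _∷ʳ_)
open import Data.List.Properties using (length-++; length-map; concatMap-++; upTo-∷ʳ; ++-identityʳ)
open import Data.List.Membership.Propositional using () renaming (_∈_ to _∈ₚ_)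
import Data.List.Membership.Propositional.Properties as ∈ₚ
import Data.List.Membership.Setoid as Membershipₛ
import Data.List.Membership.Setoid.Properties as ∈ₛ
open import Data.List.Relation.Binary.Disjoint.Setoid using (Disjoint)
open import Data.List.Relation.Binary.Subset.Setoid using (_⊆_)
open import Data.List.Relation.Unary.All as All using (All; []; _∷_)
import Data.List.Relation.Unary.All.Properties as All
open import Data.List.Relation.Unary.Any as Any using (here)
import Data.List.Relation.Unary.Any.Properties as Any
import Data.List.Relation.Unary.AllPairs as AllPairs
import Data.List.Relation.Unary.AllPairs.Properties as AllPairs
open import Data.List.Relation.Unary.AllPairs using ([]; _∷_)
import Data.List.Relation.Unary.Unique.Propositional as Unique
import Data.List.Relation.Unary.Unique.Propositional.Properties as Unique
open import Data.List.Relation.Unary.Unique.Setoid using (Unique)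
import Data.List.Relation.Unary.Unique.Setoid.Properties as Uniqueₛ
open import Data.Nat as ℕ using (ℕ; zero; suc; z<s; s<s; _+_; _∸_; _*_; _≤_; _<_; z≤n; s≤s; _<?_; NonZero; _/_; _%_)
open import Data.Nat.Properties
open import Data.Nat.DivMod
open import Data.Product using (∃-syntax; _×_; _,_; proj₁; proj₂)
open import Function using (_∘_; id; Equivalence)
open import Relation.Binary using (Setoid)
open import Relation.Binary.PropositionalEquality
open import Relation.Nullary using (yes; no; ¬_; contradiction)
open import Relation.Nullary.Decidable using (⌊_⌋; T?; fromWitness; toWitness)
open import Relation.Unary using (Decidable)

private
  variable
    A : Set
    n m : ℕ

foldr-∧≡all : (p : A → Bool) {F : List A → Bool} →
  F [] ≡ true → (∀ x xs → F (x ∷ xs) ≡ (p x ∧ F xs)) → ∀ xs → F xs ≡ all p xs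
foldr-∧≡all p F[] F∷ []       = F[]
foldr-∧≡all p F[] F∷ (x ∷ xs) = trans (F∷ x xs) (cong (p x ∧_) (foldr-∧≡all p F[] F∷ xs))

-- allB folds with a function local to its definition, reachable only by unification.
allB≡all : (p : Fin n → Bool) → allB p ≡ all p (allFin n)
allB≡all {n} p with allFin n | foldr-∧≡all p {F = _} refl (λ _ _ → refl)
... | xs | allL≡all = allL≡all xs

T-allB⁻ : (p : Fin n → Bool) → T (allB p) → ∀ i → T (p i)
T-allB⁻ p holds i rewrite allB≡all p = All.lookup (All.all⁺ p _ holds) (∈ₚ.∈-allFin i)

T-allB⁺ : (p : Fin n → Bool) → (∀ i → T (p i)) → T (allB p)
T-allB⁺ p holds rewrite allB≡all p = All.all⁻ p (All.tabulate⁺ holds)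

countB≡length-filter : (p : A → Bool) (xs : List A) → countB p xs ≡ length (filter (T? ∘ p) xs)
countB≡length-filter p []       = refl
countB≡length-filter p (x ∷ xs) with p x
... | true  = cong suc (countB≡length-filter p xs)
... | false = countB≡length-filter p xs

T-isInjectiveB⁺ : (g : Fin n → Fin n) → (∀ {i j} → g i ≡ g j → i ≡ j) → T (isInjectiveB g)
T-isInjectiveB⁺ g inj = T-allB⁺ _ λ i → T-allB⁺ _ λ j → injective-at i j
  where
  injective-at : ∀ i j → T (if ⌊ g i F.≟ g j ⌋ then ⌊ i F.≟ j ⌋ else true)
  injective-at i j with g i F.≟ g j
  ... | yes gi≡gj = fromWitness (inj gi≡gj)
  ... | no  _     = _

T-isInvolutionB⁻ : (τ : Fin n → Fin n) → T (isInvolutionB τ) → ∀ i → τ (τ i) ≡ i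
T-isInvolutionB⁻ τ involutive i = toWitness (T-allB⁻ _ involutive i)

module _ {c ℓ} (S : Setoid c ℓ) where
  open Setoid S using (_≈_) renaming (sym to ≈-sym)
  open Membershipₛ S using (_∈_)

  lookup-injective : ∀ {xs} → Unique S xs → ∀ i j → lookup xs i ≈ lookup xs j → i ≡ j
  lookup-injective (_ ∷ _)     zero    zero    _  = refl
  lookup-injective (x≉ ∷ _)    zero    (suc j) eq = ⊥-elim (All.lookup x≉ (∈ₚ.∈-lookup j) eq)
  lookup-injective (x≉ ∷ _)    (suc i) zero    eq = ⊥-elim (All.lookup x≉ (∈ₚ.∈-lookup i) (≈-sym eq))
  lookup-injective (_ ∷ xs!)   (suc i) (suc j) eq = cong suc (lookup-injective xs! i j eq)

  unique-⊆⇒length≤ : ∀ {xs ys} → Unique S xs → _⊆_ S xs ys → length xs ≤ length ys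
  unique-⊆⇒length≤ {xs} xs! xs⊆ys = injective⇒≤ λ {i} {j} eq →
    lookup-injective xs! i j (∈ₛ.index-injective S (position i) (position j) eq)
    where
    position : ∀ i → lookup xs i ∈ _
    position i = xs⊆ys (∈ₛ.∈-lookup S xs i)

≗-setoid : ℕ → ℕ → Setoid _ _
≗-setoid n m = Fin n →-setoid Fin m

allFuns-complete : ∀ n m (f : Fin n → Fin m) → ∃[ g ] g ∈ₚ allFuns n m × g ≗ f
allFuns-complete zero    m f = _ , here refl , λ ()
allFuns-complete (suc n) m f with allFuns-complete n m (f ∘ suc)
... | g , g∈ , g≗f∘suc =
  _ , ∈ₚ.∈-concatMap⁺ _ (Any.map (λ { refl → ∈ₚ.∈-map⁺ _ g∈ }) (∈ₚ.∈-allFin (f zero))) ,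
  λ { zero → refl ; (suc i) → g≗f∘suc i }

allFuns-unique : ∀ n m → Unique (≗-setoid n m) (allFuns n m)
allFuns-unique zero    m = [] ∷ []
allFuns-unique (suc n) m = Uniqueₛ.concat⁺ (≗-setoid (suc n) m)
  (All.map⁺ (All.tabulate λ _ → Uniqueₛ.map⁺ (≗-setoid n m) (≗-setoid (suc n) m)
    (λ eq i → eq (suc i)) (allFuns-unique n m)))
  (AllPairs.map⁺ (AllPairs.map heads-differ (Unique.allFin⁺ m)))
  where
  heads-differ : ∀ {a b} → a ≢ b → Disjoint (≗-setoid (suc n) m) (map _ (allFuns n m)) (map _ (allFuns n m))
  heads-differ a≢b (v∈a , v∈b) with ∈ₛ.∈-map⁻ (≗-setoid n m) (≗-setoid (suc n) m) v∈a
                                 | ∈ₛ.∈-map⁻ (≗-setoid n m) (≗-setoid (suc n) m) v∈b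
  ... | _ , _ , v≗a∷g | _ , _ , v≗b∷h = a≢b (trans (sym (v≗a∷g zero)) (v≗b∷h zero))

module _ {n m : ℕ} where
  open Membershipₛ (≗-setoid n m) using (_∈_)
  open Setoid (≗-setoid n m) using () renaming (sym to ≗-sym)

  countB-lower-bound : (p : (Fin n → Fin m) → Bool) {fs : List (Fin n → Fin m)} →
    Unique (≗-setoid n m) fs → (∀ {f} → f ∈ fs → T (p f)) → length fs ≤ countB p (allFuns n m)
  countB-lower-bound p {fs} fs! good = begin
    length fs                              ≤⟨ unique-⊆⇒length≤ (≗-setoid n m) fs! fs⊆good ⟩
    length (filter (T? ∘ p) (allFuns n m)) ≡⟨ countB≡length-filter p (allFuns n m) ⟨
    countB p (allFuns n m)                 ∎
    where
    open ≤-Reasoning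
    fs⊆good : ∀ {f} → f ∈ fs → f ∈ filter (T? ∘ p) (allFuns n m)
    fs⊆good {f} f∈fs with allFuns-complete n m f
    ... | g , g∈ , g≗f = Any.map (λ { refl → ≗-sym g≗f })
      (∈ₚ.∈-filter⁺ (T? ∘ p) g∈ (good (∈ₛ.∈-resp-≈ (≗-setoid n m) (≗-sym g≗f) f∈fs)))

length-filter≡1 : {P : A → Set} (P? : Decidable P) {xs : List A} {x : A} → Unique.Unique xs →
  x ∈ₚ xs → P x → (∀ {y} → P y → y ≡ x) → length (filter P? xs) ≡ 1
length-filter≡1 P? {xs} {x} xs! x∈xs Px only =
  singleton (Unique.filter⁺ P? xs!) (All.map only (All.all-filter P? xs)) (∈ₚ.∈-filter⁺ P? x∈xs Px)
  where
  singleton : ∀ {ys} → Unique.Unique ys → All (_≡ x) ys → x ∈ₚ ys → length ys ≡ 1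
  singleton {_ ∷ []}    _                 _                 _ = refl
  singleton {_ ∷ _ ∷ _} ((y≢z ∷ _) ∷ _) (y≡x ∷ z≡x ∷ _) _ = contradiction (trans y≡x (sym z≡x)) y≢z

module _ {c ℓ} (S : Setoid c ℓ) {F : ℕ → List (Setoid.Carrier S)} (g : ℕ → ℕ) where
  open Membershipₛ S using (_∈_)

  unique-concatMap-applyUpTo : ∀ k → (∀ {i} → i < k → Unique S (F (g i))) →
    (∀ {i j} → i < j → j < k → Disjoint S (F (g i)) (F (g j))) → Unique S (concatMap F (applyUpTo g k))
  unique-concatMap-applyUpTo k unique disjoint = Uniqueₛ.concat⁺ S
    (All.map⁺ (All.applyUpTo⁺₁ g k unique)) (AllPairs.map⁺ (AllPairs.applyUpTo⁺₁ g k disjoint))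

  ∈-concatMap-applyUpTo⁻ : ∀ {k v} → v ∈ concatMap F (applyUpTo g k) → ∃[ i ] i < k × v ∈ F (g i)
  ∈-concatMap-applyUpTo⁻ v∈ = Any.applyUpTo⁻ g (∈ₛ.∈-concatMap⁻ (setoid ℕ) S v∈)

length-concatMap-applyUpTo : ∀ {F : ℕ → List A} (g : ℕ → ℕ) k {ℓ} →
  (∀ {i} → i < k → length (F (g i)) ≡ ℓ) → length (concatMap F (applyUpTo g k)) ≡ k * ℓ
length-concatMap-applyUpTo g zero    lengths = refl
length-concatMap-applyUpTo {F = F} g (suc k) lengths = trans (length-++ (F (g 0)))
  (cong₂ _+_ (lengths z<s) (length-concatMap-applyUpTo {F = F} (g ∘ suc) k (lengths ∘ s<s)))

*-sumFrom1 : ∀ c k (f : ℕ → ℕ) → c * sumFrom1 k f ≡ sumFrom1 k (λ i → c * f i)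
*-sumFrom1 c zero    f = *-zeroʳ c
*-sumFrom1 c (suc k) f = trans (*-distribˡ-+ c (sumFrom1 k f) (f (suc k))) (cong (_+ c * f (suc k)) (*-sumFrom1 c k f))

concatMap-upTo-suc : (F : ℕ → List A) (k : ℕ) → concatMap F (upTo (suc k)) ≡ concatMap F (upTo k) ++ F k
concatMap-upTo-suc F k = begin
  concatMap F (upTo (suc k))        ≡⟨ cong (concatMap F) (upTo-∷ʳ k) ⟨
  concatMap F (upTo k ∷ʳ k)         ≡⟨ concatMap-++ F (upTo k) (k ∷ []) ⟩
  concatMap F (upTo k) ++ F k ++ [] ≡⟨ cong (concatMap F (upTo k) ++_) (++-identityʳ (F k)) ⟩
  concatMap F (upTo k) ++ F k       ∎
  where open ≡-Reasoning

sumFrom1≤length-concatMap-upTo : ∀ {F : ℕ → List A} k (f : ℕ → ℕ) →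
  (∀ {i} → i < k → f (suc i) ≤ length (F i)) → sumFrom1 k f ≤ length (concatMap F (upTo k))
sumFrom1≤length-concatMap-upTo zero    f bounds = z≤n
sumFrom1≤length-concatMap-upTo {F = F} (suc k) f bounds = begin
  sumFrom1 k f + f (suc k)                     ≤⟨ +-mono-≤ earlier (bounds (n<1+n k)) ⟩
  length (concatMap F (upTo k)) + length (F k) ≡⟨ length-++ (concatMap F (upTo k)) ⟨
  length (concatMap F (upTo k) ++ F k)         ≡⟨ cong length (concatMap-upTo-suc F k) ⟨
  length (concatMap F (upTo (suc k)))          ∎
  where
  open ≤-Reasoning
  earlier : sumFrom1 k f ≤ length (concatMap F (upTo k))
  earlier = sumFrom1≤length-concatMap-upTo k f (bounds ∘ m<n⇒m<1+n)

record _Realises_ (g : Fin n → Fin n) (P : ℕ → ℕ) : Set where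
  field
    realises : ∀ x → toℕ (g x) ≡ P (toℕ x)

open _Realises_

-- Junk value: x itself wherever P leaves [0, n).
realise : (n : ℕ) → (ℕ → ℕ) → Fin n → Fin n
realise n P x with P (toℕ x) <? n
... | yes P<n = fromℕ< P<n
... | no  _   = x

realise-realises : {P : ℕ → ℕ} → (∀ {x} → x < n → P x < n) → realise n P Realises P
realises (realise-realises {n} {P} P<) x with P (toℕ x) <? n
... | yes P<n = toℕ-fromℕ< P<n
... | no  P≮n = contradiction (P< (toℕ<n x)) P≮n

liftℕ : (Fin m → Fin m) → ℕ → ℕ
liftℕ {m} τ y with y <? m
... | yes y<m = toℕ (τ (fromℕ< y<m))
... | no  _   = y

liftℕ-toℕ : (τ : Fin m → Fin m) (i : Fin m) → liftℕ τ (toℕ i) ≡ toℕ (τ i)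
liftℕ-toℕ {m} τ i with toℕ i <? m
... | yes i<m = cong (toℕ ∘ τ) (fromℕ<-toℕ i i<m)
... | no  i≮m = contradiction (toℕ<n i) i≮m

liftℕ-< : (τ : Fin m → Fin m) → ∀ {y} → y < m → liftℕ τ y < m
liftℕ-< {m} τ {y} y<m with y <? m
... | yes _   = toℕ<n _
... | no  y≮m = contradiction y<m y≮m

liftℕ-≮ : (τ : Fin m → Fin m) → ∀ {y} → ¬ y < m → liftℕ τ y ≡ y
liftℕ-≮ {m} τ {y} y≮m with y <? m
... | yes y<m = contradiction y<m y≮m
... | no  _   = refl

liftℕ-involutive : (τ : Fin m → Fin m) → (∀ i → τ (τ i) ≡ i) → ∀ y → liftℕ τ (liftℕ τ y) ≡ y
liftℕ-involutive {m} τ τ²≡id y with y <? m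
... | no  y≮m = liftℕ-≮ τ y≮m
... | yes y<m = begin
  liftℕ τ (toℕ (τ i)) ≡⟨ liftℕ-toℕ τ (τ i) ⟩
  toℕ (τ (τ i))       ≡⟨ cong toℕ (τ²≡id i) ⟩
  toℕ i               ≡⟨ toℕ-fromℕ< y<m ⟩
  y                   ∎
  where
  open ≡-Reasoning
  i : Fin m
  i = fromℕ< y<m

module _ {g : Fin n → Fin n} {P : ℕ → ℕ} (g≈P : g Realises P) where

  ≗-realises : {h : Fin n → Fin n} → h ≗ g → h Realises P
  realises (≗-realises h≗g) x = trans (cong toℕ (h≗g x)) (realises g≈P x)

  ∘-realises : {h : Fin n → Fin n} {P′ : ℕ → ℕ} → h Realises P′ → (g ∘ h) Realises (P ∘ P′)
  realises (∘-realises h≈P′) x = trans (realises g≈P _) (cong P (realises h≈P′ x))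

  realises-injective : (∀ {x y} → x < n → y < n → P x ≡ P y → x ≡ y) → ∀ {i j} → g i ≡ g j → i ≡ j
  realises-injective P-inj {i} {j} gi≡gj =
    toℕ-injective (P-inj (toℕ<n i) (toℕ<n j)
      (trans (sym (realises g≈P i)) (trans (cong toℕ gi≡gj) (realises g≈P j))))

  realises-agree : {h : Fin n → Fin n} {P′ : ℕ → ℕ} → h Realises P′ → g ≗ h →
    ∀ {x} → x < n → P x ≡ P′ x
  realises-agree {h} {P′} h≈P′ g≗h {x} x<n = begin
    P x                ≡⟨ cong P (toℕ-fromℕ< x<n) ⟨
    P (toℕ i)          ≡⟨ realises g≈P i ⟨
    toℕ (g i)          ≡⟨ cong toℕ (g≗h i) ⟩
    toℕ (h i)          ≡⟨ realises h≈P′ i ⟩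
    P′ (toℕ i)         ≡⟨ cong P′ (toℕ-fromℕ< x<n) ⟩
    P′ x               ∎
    where
    open ≡-Reasoning
    i : Fin n
    i = fromℕ< x<n

descents≡1 : {g : Fin n → Fin n} {P : ℕ → ℕ} → g Realises P → ∀ {c} → suc c < n → P (suc c) < P c →
  (∀ {x} → suc x < n → P (suc x) < P x → x ≡ c) → descents g ≡ 1
descents≡1 {suc n} {g} {P} g≈P {c} (s≤s c<n) descent-at-c only =
  length-filter≡1 _ (Unique.allFin⁺ n) (∈ₚ.∈-allFin c′) (is-descent (toℕ-fromℕ< c<n)) only-descent
  where
  c′ : Fin n
  c′ = fromℕ< c<n
  g∘inject₁≈P : ∀ i → toℕ (g (inject₁ i)) ≡ P (toℕ i)
  g∘inject₁≈P i = trans (realises g≈P (inject₁ i)) (cong P (toℕ-inject₁ i))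
  is-descent : ∀ {i} → toℕ i ≡ c → toℕ (g (suc i)) < toℕ (g (inject₁ i))
  is-descent {i} refl = subst₂ _<_ (sym (realises g≈P (suc i))) (sym (g∘inject₁≈P i)) descent-at-c
  only-descent : ∀ {i} → toℕ (g (suc i)) < toℕ (g (inject₁ i)) → i ≡ c′
  only-descent {i} d = toℕ-injective (trans
    (only (s≤s (toℕ<n i)) (subst₂ _<_ (realises g≈P (suc i)) (g∘inject₁≈P i) d)) (sym (toℕ-fromℕ< c<n)))

rotate : (s : ℕ) .{{_ : NonZero s}} → ℕ → ℕ → ℕ
rotate s u j = (j + u) % s

module _ {s : ℕ} .{{_ : NonZero s}} where

  [m%s+n]%s≡[m+n]%s : ∀ m n → (m % s + n) % s ≡ (m + n) % s
  [m%s+n]%s≡[m+n]%s m n = begin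
    (m % s + n) % s         ≡⟨ %-distribˡ-+ (m % s) n s ⟩
    (m % s % s + n % s) % s ≡⟨ cong (λ k → (k + n % s) % s) (m%n%n≡m%n m s) ⟩
    (m % s + n % s) % s     ≡⟨ %-distribˡ-+ m n s ⟨
    (m + n) % s             ∎
    where open ≡-Reasoning

  rotate-< : ∀ u j → rotate s u j < s
  rotate-< u j = m%n<n (j + u) s

  rotate-∘ : ∀ u v j → rotate s u (rotate s v j) ≡ rotate s (v + u) j
  rotate-∘ u v j = trans ([m%s+n]%s≡[m+n]%s (j + v) u) (cong (_% s) (+-assoc j v u))

  rotate-% : ∀ u j → rotate s (u % s) j ≡ rotate s u j
  rotate-% u j = begin
    (j + u % s) % s ≡⟨ cong (_% s) (+-comm j (u % s)) ⟩
    (u % s + j) % s ≡⟨ [m%s+n]%s≡[m+n]%s u j ⟩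
    (u + j) % s     ≡⟨ cong (_% s) (+-comm u j) ⟩
    (j + u) % s     ∎
    where open ≡-Reasoning

  rotate-no-wrap : ∀ {u j} → j + u < s → rotate s u j ≡ j + u
  rotate-no-wrap = m<n⇒m%n≡m

  rotate-wrap : ∀ {u j} → s ≤ j + u → j + u < s + s → rotate s u j + s ≡ j + u
  rotate-wrap {u} {j} s≤j+u j+u<2s = begin
    (j + u) % s + s       ≡⟨ cong (_+ s) (m≤n⇒[n∸m]%m≡n%m s≤j+u) ⟨
    (j + u ∸ s) % s + s   ≡⟨ cong (_+ s) (m<n⇒m%n≡m (m<n+o⇒m∸n<o (j + u) s j+u<2s)) ⟩
    j + u ∸ s + s         ≡⟨ m∸n+n≡m s≤j+u ⟩
    j + u                 ∎
    where open ≡-Reasoning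

  rotate-inverse : ∀ {u j} → u ≤ s → j < s → rotate s (s ∸ u) (rotate s u j) ≡ j
  rotate-inverse {u} {j} u≤s j<s = begin
    rotate s (s ∸ u) (rotate s u j) ≡⟨ rotate-∘ (s ∸ u) u j ⟩
    (j + (u + (s ∸ u))) % s         ≡⟨ cong (λ k → (j + k) % s) (m+[n∸m]≡n u≤s) ⟩
    (j + s) % s                     ≡⟨ [m+n]%n≡m%n j s ⟩
    j % s                           ≡⟨ m<n⇒m%n≡m j<s ⟩
    j                               ∎
    where open ≡-Reasoning

  rotate-no-fixed : ∀ {u j} → 0 < u → u < s → j < s → rotate s u j ≢ j
  rotate-no-fixed {u} {j} 0<u u<s j<s rot≡j with j + u <? s
  ... | yes j+u<s = <⇒≢ (m<m+n j 0<u) (trans (sym rot≡j) (rotate-no-wrap {u} {j} j+u<s))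
  ... | no  j+u≮s = <⇒≢ u<s (sym (+-cancelˡ-≡ j s u
    (trans (cong (_+ s) (sym rot≡j)) (rotate-wrap {u} {j} (≮⇒≥ j+u≮s) (+-mono-< j<s u<s)))))

  rotate-descent : ∀ {u} → 0 < u → u < s → rotate s u (suc (s ∸ suc u)) < rotate s u (s ∸ suc u)
  rotate-descent {u} 0<u u<s = begin-strict
    rotate s u (suc c) ≡⟨ cong (_% s) 1+c+u≡s ⟩
    s % s              ≡⟨ n%n≡0 s ⟩
    0                  <⟨ ≤-trans 0<u (m≤n+m u c) ⟩
    c + u              ≡⟨ rotate-no-wrap {u} {c} (subst (c + u <_) 1+c+u≡s (n<1+n _)) ⟨
    rotate s u c       ∎
    where
    open ≤-Reasoning
    c : ℕ
    c = s ∸ suc u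
    1+c+u≡s : suc c + u ≡ s
    1+c+u≡s = trans (sym (+-suc c u)) (m∸n+n≡m u<s)

  rotate-descent-unique : ∀ {u j} → u < s → suc j < s → rotate s u (suc j) < rotate s u j → j ≡ s ∸ suc u
  rotate-descent-unique {u} {j} u<s 1+j<s descent with j + u <? s | suc j + u <? s
  ... | _         | yes 1+j+u<s = contradiction
    (subst₂ _<_ (rotate-no-wrap {u} {suc j} 1+j+u<s) (rotate-no-wrap {u} {j} (<-trans (n<1+n _) 1+j+u<s)) descent)
    (≤⇒≯ (n≤1+n (j + u)))
  ... | yes j+u<s | no  1+j+u≮s = begin
    j                   ≡⟨ m+n∸n≡m j (suc u) ⟨
    j + suc u ∸ suc u   ≡⟨ cong (_∸ suc u) (trans (+-suc j u) (≤-antisym j+u<s (≮⇒≥ 1+j+u≮s))) ⟩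
    s ∸ suc u           ∎
    where open ≡-Reasoning
  ... | no  j+u≮s | no  1+j+u≮s = contradiction (subst (_< rotate s u j) rotate-step descent) (≤⇒≯ (n≤1+n _))
    where
    rotate-step : rotate s u (suc j) ≡ suc (rotate s u j)
    rotate-step = +-cancelʳ-≡ s _ _ (trans
      (rotate-wrap {u} {suc j} (≮⇒≥ 1+j+u≮s) (+-mono-< 1+j<s u<s))
      (cong suc (sym (rotate-wrap {u} {j} (≮⇒≥ j+u≮s) (+-mono-< (<-trans (n<1+n j) 1+j<s) u<s)))))

record Support (Q : ℕ → ℕ) (a s : ℕ) : Set where
  field
    moves        : ∀ {j} → j < s → Q (a + j) ≢ a + j
    fixes-before : ∀ {x} → x < a → Q x ≡ x
    fixes-after  : ∀ {x} → a + s ≤ x → Q x ≡ x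

module _ {n : ℕ} where
  open Support

  private
    start-≮ : ∀ {a s a′ s′ Q Q′} → Support Q a s → Support Q′ a′ s′ → 0 < s → a + s ≤ n →
      (∀ {x} → x < n → Q x ≡ Q′ x) → ¬ a < a′
    start-≮ {a} supp supp′ 0<s a+s≤n agree a<a′ = moves supp 0<s (trans
      (agree (<-≤-trans (+-monoʳ-< a 0<s) a+s≤n))
      (fixes-before supp′ (subst (_< _) (sym (+-identityʳ a)) a<a′)))

    length-≮ : ∀ {a s s′ Q Q′} → Support Q a s → Support Q′ a s′ → a + s′ ≤ n →
      (∀ {x} → x < n → Q x ≡ Q′ x) → ¬ s < s′
    length-≮ {a} supp supp′ a+s′≤n agree s<s′ = moves supp′ s<s′ (trans
      (sym (agree (<-≤-trans (+-monoʳ-< a s<s′) a+s′≤n)))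
      (fixes-after supp ≤-refl))

  support-unique : ∀ {a s a′ s′ Q Q′} → Support Q a s → Support Q′ a′ s′ → 0 < s → 0 < s′ →
    a + s ≤ n → a′ + s′ ≤ n → (∀ {x} → x < n → Q x ≡ Q′ x) → a ≡ a′ × s ≡ s′
  support-unique supp supp′ 0<s 0<s′ a+s≤n a′+s′≤n agree
    with ≤-antisym (≮⇒≥ (start-≮ supp′ supp 0<s′ a′+s′≤n (sym ∘ agree)))
                   (≮⇒≥ (start-≮ supp supp′ 0<s a+s≤n agree))
  ... | refl = refl , ≤-antisym (≮⇒≥ (length-≮ supp′ supp a+s≤n (sym ∘ agree)))
                                (≮⇒≥ (length-≮ supp supp′ a′+s′≤n agree))

module Splice (a s : ℕ) where

  skip : ℕ → ℕ
  skip y with y <? a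
  ... | yes _ = y
  ... | no  _ = y + s

  -- splice ρ T is ρ on the block [a, a + s) and T on its complement, numbered along skip.
  splice : (ρ T : ℕ → ℕ) → ℕ → ℕ
  splice ρ T x with x <? a | x <? a + s
  ... | yes _ | _     = skip (T x)
  ... | no  _ | yes _ = a + ρ (x ∸ a)
  ... | no  _ | no  _ = skip (T (x ∸ s))

  data Region (x : ℕ) : Set where
    before : x < a → Region x
    inside : ∀ {j} → j < s → x ≡ a + j → Region x
    after  : a + s ≤ x → Region x

  region : ∀ x → Region x
  region x with x <? a | x <? a + s
  ... | yes x<a | _         = before x<a
  ... | no  x≮a | yes x<a+s = inside (+-cancelˡ-< a _ _ (subst (_< a + s) (sym a+[x∸a]≡x) x<a+s)) (sym a+[x∸a]≡x)
    where
    a+[x∸a]≡x : a + (x ∸ a) ≡ x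
    a+[x∸a]≡x = m+[n∸m]≡n (≮⇒≥ x≮a)
  ... | no  _   | no  x≮a+s = after (≮⇒≥ x≮a+s)

  skip-below : ∀ {y} → y < a → skip y ≡ y
  skip-below {y} y<a with y <? a
  ... | yes _   = refl
  ... | no  y≮a = contradiction y<a y≮a

  skip-above : ∀ {y} → a ≤ y → skip y ≡ y + s
  skip-above {y} a≤y with y <? a
  ... | yes y<a = contradiction a≤y (<⇒≱ y<a)
  ... | no  _   = refl

  skip-injective : ∀ {y y′} → skip y ≡ skip y′ → y ≡ y′
  skip-injective {y} {y′} eq with y <? a | y′ <? a
  ... | yes _   | yes _    = eq
  ... | yes y<a | no  y′≮a = contradiction (subst (_< a) eq y<a) (≤⇒≯ (≤-trans (≮⇒≥ y′≮a) (m≤m+n y′ s)))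
  ... | no  y≮a | yes y′<a = contradiction (subst (_< a) (sym eq) y′<a) (≤⇒≯ (≤-trans (≮⇒≥ y≮a) (m≤m+n y s)))
  ... | no  _   | no  _    = +-cancelʳ-≡ s y y′ eq

  skip-bounded : ∀ {n y} → a + s ≤ n → y < n ∸ s → skip y < n
  skip-bounded {n} {y} a+s≤n y<n∸s with y <? a
  ... | yes _ = <-≤-trans y<n∸s (m∸n≤m n s)
  ... | no  _ = subst (y + s <_) (m∸n+n≡m (m+n≤o⇒n≤o a a+s≤n)) (+-monoˡ-< s y<n∸s)

  module _ {ρ T : ℕ → ℕ} where

    splice-before : ∀ {x} → x < a → splice ρ T x ≡ skip (T x)
    splice-before {x} x<a with x <? a
    ... | yes _   = refl
    ... | no  x≮a = contradiction x<a x≮a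

    splice-inside : ∀ {j} → j < s → splice ρ T (a + j) ≡ a + ρ j
    splice-inside {j} j<s with a + j <? a | a + j <? a + s
    ... | yes a+j<a | _           = contradiction a+j<a (≤⇒≯ (m≤m+n a j))
    ... | no  _     | yes _       = cong (λ k → a + ρ k) (m+n∸m≡n a j)
    ... | no  _     | no  a+j≮a+s = contradiction (+-monoʳ-< a j<s) a+j≮a+s

    splice-after : ∀ {x} → a + s ≤ x → splice ρ T x ≡ skip (T (x ∸ s))
    splice-after {x} a+s≤x with x <? a | x <? a + s
    ... | yes x<a | _         = contradiction (≤-trans (m≤m+n a s) a+s≤x) (<⇒≱ x<a)
    ... | no  _   | yes x<a+s = contradiction a+s≤x (<⇒≱ x<a+s)
    ... | no  _   | no  _     = refl

    splice-skip : ∀ y → splice ρ T (skip y) ≡ skip (T y)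
    splice-skip y with y <? a
    ... | yes y<a = splice-before y<a
    ... | no  y≮a = trans (splice-after (+-monoˡ-≤ s (≮⇒≥ y≮a))) (cong (skip ∘ T) (m+n∸n≡m y s))

    splice-bounded : ∀ {n} → a + s ≤ n → (∀ {j} → j < s → ρ j < s) → (∀ {y} → y < n ∸ s → T y < n ∸ s) →
      ∀ {x} → x < n → splice ρ T x < n
    splice-bounded {n} a+s≤n ρ-< T-< {x} x<n with region x
    ... | before x<a      = subst (_< n) (sym (splice-before x<a))
                              (skip-bounded a+s≤n (T-< (<-≤-trans x<a (m+n≤o⇒m≤o∸n a a+s≤n))))
    ... | inside j<s refl = subst (_< n) (sym (splice-inside j<s)) (<-≤-trans (+-monoʳ-< a (ρ-< j<s)) a+s≤n)
    ... | after a+s≤x     = subst (_< n) (sym (splice-after a+s≤x))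
                              (skip-bounded a+s≤n (T-< (∸-monoˡ-< x<n (m+n≤o⇒n≤o a a+s≤x))))

  splice-cong : ∀ {ρ ρ′ T T′} → (∀ {j} → j < s → ρ j ≡ ρ′ j) → T ≗ T′ → splice ρ T ≗ splice ρ′ T′
  splice-cong {ρ} {ρ′} {T} {T′} ρ≈ρ′ T≗T′ x with region x
  ... | before x<a      = trans (splice-before x<a) (trans (cong skip (T≗T′ x)) (sym (splice-before x<a)))
  ... | inside j<s refl = trans (splice-inside j<s) (trans (cong (a +_) (ρ≈ρ′ j<s)) (sym (splice-inside j<s)))
  ... | after a+s≤x     = trans (splice-after a+s≤x) (trans (cong skip (T≗T′ _)) (sym (splice-after a+s≤x)))

  splice-∘ : ∀ {ρ ρ′ T T′} → (∀ j → ρ′ j < s) → ∀ x →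
    splice ρ T (splice ρ′ T′ x) ≡ splice (ρ ∘ ρ′) (T ∘ T′) x
  splice-∘ {ρ} {ρ′} {T} {T′} ρ′-< x with region x
  ... | before x<a = begin
    splice ρ T (splice ρ′ T′ x) ≡⟨ cong (splice ρ T) (splice-before x<a) ⟩
    splice ρ T (skip (T′ x))    ≡⟨ splice-skip (T′ x) ⟩
    skip (T (T′ x))             ≡⟨ splice-before x<a ⟨
    splice (ρ ∘ ρ′) (T ∘ T′) x  ∎
    where open ≡-Reasoning
  ... | inside {j} j<s refl = begin
    splice ρ T (splice ρ′ T′ (a + j)) ≡⟨ cong (splice ρ T) (splice-inside j<s) ⟩
    splice ρ T (a + ρ′ j)             ≡⟨ splice-inside (ρ′-< j) ⟩
    a + ρ (ρ′ j)                      ≡⟨ splice-inside j<s ⟨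
    splice (ρ ∘ ρ′) (T ∘ T′) (a + j)  ∎
    where open ≡-Reasoning
  ... | after a+s≤x = begin
    splice ρ T (splice ρ′ T′ x)    ≡⟨ cong (splice ρ T) (splice-after a+s≤x) ⟩
    splice ρ T (skip (T′ (x ∸ s))) ≡⟨ splice-skip (T′ (x ∸ s)) ⟩
    skip (T (T′ (x ∸ s)))          ≡⟨ splice-after a+s≤x ⟨
    splice (ρ ∘ ρ′) (T ∘ T′) x     ∎
    where open ≡-Reasoning

  splice-id-before : ∀ {ρ x} → x < a → splice ρ id x ≡ x
  splice-id-before x<a = trans (splice-before x<a) (skip-below x<a)

  splice-id-after : ∀ {ρ x} → a + s ≤ x → splice ρ id x ≡ x
  splice-id-after {ρ} {x} a+s≤x = begin
    splice ρ id x ≡⟨ splice-after a+s≤x ⟩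
    skip (x ∸ s)  ≡⟨ skip-above (m+n≤o⇒m≤o∸n a a+s≤x) ⟩
    x ∸ s + s     ≡⟨ m∸n+n≡m (m+n≤o⇒n≤o a a+s≤x) ⟩
    x             ∎
    where open ≡-Reasoning

  splice-id : ∀ x → splice id id x ≡ x
  splice-id x with region x
  ... | before x<a      = splice-id-before x<a
  ... | inside j<s refl = splice-inside j<s
  ... | after a+s≤x     = splice-id-after a+s≤x

  splice-id-support : ∀ {ρ} → (∀ {j} → j < s → ρ j ≢ j) → Support (splice ρ id) a s
  splice-id-support ρ-no-fixed = record
    { moves        = λ j<s fixed → ρ-no-fixed j<s (+-cancelˡ-≡ a _ _ (trans (sym (splice-inside j<s)) fixed))
    ; fixes-before = splice-id-before
    ; fixes-after  = splice-id-after
    }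

  module _ {ρ : ℕ → ℕ} (ρ-< : ∀ j → ρ j < s) where

    splice-id-descent : ∀ {c} → suc c < s → ρ (suc c) < ρ c → splice ρ id (suc (a + c)) < splice ρ id (a + c)
    splice-id-descent {c} 1+c<s descent = subst₂ _<_
      (sym (trans (cong (splice ρ id) (sym (+-suc a c))) (splice-inside 1+c<s)))
      (sym (splice-inside (<-trans (n<1+n c) 1+c<s)))
      (+-monoʳ-< a descent)

    private
      fixed-points-ascend : ∀ {x} → splice ρ id (suc x) ≡ suc x → splice ρ id x ≡ x →
        ¬ splice ρ id (suc x) < splice ρ id x
      fixed-points-ascend {x} fixes-1+x fixes-x descent = ≤⇒≯ (n≤1+n x) (subst₂ _<_ fixes-1+x fixes-x descent)

    splice-id-descent-unique : ∀ {c} → (∀ {j} → suc j < s → ρ (suc j) < ρ j → j ≡ c) →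
      ∀ {x} → splice ρ id (suc x) < splice ρ id x → x ≡ a + c
    splice-id-descent-unique only {x} descent with region x | region (suc x)
    ... | before x<a | before 1+x<a =
      contradiction descent (fixed-points-ascend (splice-id-before 1+x<a) (splice-id-before x<a))
    ... | before x<a | inside j′<s 1+x≡a+j′ = contradiction
      (subst₂ _<_ (trans (cong (splice ρ id) 1+x≡a+j′) (splice-inside j′<s)) (splice-id-before x<a) descent)
      (≤⇒≯ (≤-trans (<⇒≤ x<a) (m≤m+n a _)))
    ... | before x<a | after a+s≤1+x =
      contradiction descent (fixed-points-ascend (splice-id-after a+s≤1+x) (splice-id-before x<a))
    ... | after a+s≤x | _ =
      contradiction descent (fixed-points-ascend (splice-id-after (≤-trans a+s≤x (n≤1+n x))) (splice-id-after a+s≤x))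
    ... | inside {j} j<s refl | before 1+x<a = contradiction 1+x<a (≤⇒≯ (≤-trans (m≤m+n a j) (n≤1+n _)))
    ... | inside {j} j<s refl | after a+s≤1+x = contradiction
      (subst₂ _<_ (splice-id-after a+s≤1+x) (splice-inside j<s) descent)
      (≤⇒≯ (≤-trans (<⇒≤ (+-monoʳ-< a (ρ-< j))) a+s≤1+x))
    ... | inside {j} j<s refl | inside {j′} j′<s 1+x≡a+j′ =
      cong (a +_) (only (subst (_< s) j′≡1+j j′<s)
        (+-cancelˡ-< a _ _ (subst₂ _<_ Q[1+x]≡ (splice-inside j<s) descent)))
      where
      j′≡1+j : j′ ≡ suc j
      j′≡1+j = +-cancelˡ-≡ a j′ (suc j) (trans (sym 1+x≡a+j′) (sym (+-suc a j)))
      Q[1+x]≡ : splice ρ id (suc (a + j)) ≡ a + ρ (suc j)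
      Q[1+x]≡ = trans (cong (splice ρ id) 1+x≡a+j′) (trans (splice-inside j′<s) (cong (λ k → a + ρ k) j′≡1+j))

record Shape (n s a t : ℕ) : Set where
  field
    fits  : a + s ≤ n
    0<t   : 0 < t
    t<s   : t < s
    t+t≢s : t + t ≢ s

perm : (n s : ℕ) .{{_ : NonZero s}} (a t : ℕ) → (Fin (n ∸ s) → Fin (n ∸ s)) → Fin n → Fin n
perm n s a t τ = realise n (Splice.splice a s (rotate s t) (liftℕ τ))

module Block {n s a t : ℕ} .{{_ : NonZero s}} (shape : Shape n s a t) where
  open Shape shape
  open Splice a s

  P : (Fin (n ∸ s) → Fin (n ∸ s)) → ℕ → ℕ
  P τ = splice (rotate s t) (liftℕ τ)

  P-bounded : ∀ τ {x} → x < n → P τ x < n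
  P-bounded τ = splice-bounded fits (λ {j} _ → rotate-< t j) (liftℕ-< τ)

  perm-realises : ∀ τ → perm n s a t τ Realises P τ
  perm-realises τ = realise-realises (P-bounded τ)

  0<s : 0 < s
  0<s = <-trans 0<t t<s

  P-start : ∀ τ → P τ a ≡ a + t
  P-start τ = begin
    P τ a                ≡⟨ cong (P τ) (+-identityʳ a) ⟨
    P τ (a + 0)          ≡⟨ splice-inside 0<s ⟩
    a + rotate s t 0     ≡⟨ cong (a +_) (m<n⇒m%n≡m t<s) ⟩
    a + t                ∎
    where open ≡-Reasoning

  u : ℕ
  u = (t + t) % s

  u<s : u < s
  u<s = m%n<n (t + t) s

  0<u : 0 < u
  0<u with t + t <? s
  ... | yes t+t<s = subst (0 <_) (sym (m<n⇒m%n≡m t+t<s)) (≤-trans 0<t (m≤m+n t t))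
  ... | no  t+t≮s = n≢0⇒n>0 λ u≡0 → t+t≢s (sym (begin
    s      ≡⟨ cong (_+ s) u≡0 ⟨
    u + s  ≡⟨ rotate-wrap {u = t} {j = t} (≮⇒≥ t+t≮s) (+-mono-< t<s t<s) ⟩
    t + t  ∎))
    where open ≡-Reasoning

  Q : ℕ → ℕ
  Q = splice (rotate s u) id

  P∘P≗Q : ∀ τ → (∀ i → τ (τ i) ≡ i) → ∀ x → P τ (P τ x) ≡ Q x
  P∘P≗Q τ involutive x = begin
    P τ (P τ x)                                            ≡⟨ splice-∘ (rotate-< t) x ⟩
    splice (rotate s t ∘ rotate s t) (liftℕ τ ∘ liftℕ τ) x ≡⟨ splice-cong rotate-twice
                                                                (liftℕ-involutive τ involutive) x ⟩
    Q x                                                    ∎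
    where
    open ≡-Reasoning
    rotate-twice : ∀ {j} → j < s → rotate s t (rotate s t j) ≡ rotate s u j
    rotate-twice {j} _ = trans (rotate-∘ t t j) (sym (rotate-% (t + t) j))

  Q-injective : ∀ {x y} → Q x ≡ Q y → x ≡ y
  Q-injective {x} {y} Qx≡Qy = trans (sym (Q⁻¹∘Q x)) (trans (cong Q⁻¹ Qx≡Qy) (Q⁻¹∘Q y))
    where
    Q⁻¹ : ℕ → ℕ
    Q⁻¹ = splice (rotate s (s ∸ u)) id
    Q⁻¹∘Q : ∀ x → Q⁻¹ (Q x) ≡ x
    Q⁻¹∘Q x = trans (splice-∘ (rotate-< u) x)
             (trans (splice-cong (λ j<s → rotate-inverse (<⇒≤ u<s) j<s) (λ _ → refl) x) (splice-id x))

  Q-support : Support Q a s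
  Q-support = splice-id-support (rotate-no-fixed 0<u u<s)

  c′ : ℕ
  c′ = s ∸ suc u

  c′+1<s : suc c′ < s
  c′+1<s = subst (suc c′ <_) (trans (sym (+-suc c′ u)) (m∸n+n≡m u<s)) (m<m+n (suc c′) 0<u)

  c : ℕ
  c = a + c′

  c+1<n : suc c < n
  c+1<n = subst (_< n) (+-suc a c′) (<-≤-trans (+-monoʳ-< a c′+1<s) fits)

  Q-descent : Q (suc c) < Q c
  Q-descent = splice-id-descent (rotate-< u) c′+1<s (rotate-descent 0<u u<s)

  Q-descent-unique : ∀ {x} → Q (suc x) < Q x → x ≡ c
  Q-descent-unique = splice-id-descent-unique (rotate-< u) (rotate-descent-unique u<s)

module _ {n s a t : ℕ} .{{_ : NonZero s}} (shape : Shape n s a t) where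
  open Block shape
  open Splice a s using (skip; skip-injective; skip-bounded; splice-skip)

  perm-good : ∀ {τ g} → (∀ i → τ (τ i) ≡ i) → g ≗ perm n s a t τ →
    T (isInjectiveB g ∧ ⌊ descents (λ i → g (g i)) ℕ.≟ 1 ⌋)
  perm-good {τ} {g} involutive g≗perm =
    Equivalence.from T-∧ (T-isInjectiveB⁺ g g-injective , fromWitness g²-has-one-descent)
    where
    g≈P : g Realises P τ
    g≈P = ≗-realises (perm-realises τ) g≗perm
    g²≈Q : (λ i → g (g i)) Realises Q
    realises g²≈Q x = trans (realises (∘-realises g≈P g≈P) x) (P∘P≗Q τ involutive (toℕ x))
    g-injective : ∀ {i j} → g i ≡ g j → i ≡ j
    g-injective gi≡gj = realises-injective g²≈Q (λ _ _ → Q-injective) (cong g gi≡gj)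
    g²-has-one-descent : descents (λ i → g (g i)) ≡ 1
    g²-has-one-descent = descents≡1 g²≈Q c+1<n Q-descent (λ _ → Q-descent-unique)

  perm-injective : ∀ {τ τ′} → perm n s a t τ ≗ perm n s a t τ′ → τ ≗ τ′
  perm-injective {τ} {τ′} perm≗perm i = toℕ-injective (skip-injective (begin
    skip (toℕ (τ i))        ≡⟨ cong skip (liftℕ-toℕ τ i) ⟨
    skip (liftℕ τ (toℕ i))  ≡⟨ splice-skip (toℕ i) ⟨
    P τ (skip (toℕ i))      ≡⟨ realises-agree (perm-realises τ) (perm-realises τ′) perm≗perm
                                  (skip-bounded (Shape.fits shape) (toℕ<n i)) ⟩
    P τ′ (skip (toℕ i))     ≡⟨ splice-skip (toℕ i) ⟩
    skip (liftℕ τ′ (toℕ i)) ≡⟨ cong skip (liftℕ-toℕ τ′ i) ⟩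
    skip (toℕ (τ′ i))       ∎))
    where open ≡-Reasoning

module _ {n s a t s′ a′ t′ : ℕ} .{{_ : NonZero s}} .{{_ : NonZero s′}}
         (shape : Shape n s a t) (shape′ : Shape n s′ a′ t′) where
  private
    module B  = Block shape
    module B′ = Block shape′

  perm-shape-injective : ∀ {τ τ′} → (∀ i → τ (τ i) ≡ i) → (∀ i → τ′ (τ′ i) ≡ i) →
    perm n s a t τ ≗ perm n s′ a′ t′ τ′ → s ≡ s′ × a ≡ a′ × t ≡ t′
  perm-shape-injective {τ} {τ′} involutive involutive′ perm≗perm′ = s≡s′ , a≡a′ , t≡t′
    where
    open ≡-Reasoning
    P≈P′ : ∀ {x} → x < n → B.P τ x ≡ B′.P τ′ x
    P≈P′ = realises-agree (B.perm-realises τ) (B′.perm-realises τ′) perm≗perm′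
    Q≈Q′ : ∀ {x} → x < n → B.Q x ≡ B′.Q x
    Q≈Q′ {x} x<n = begin
      B.Q x               ≡⟨ B.P∘P≗Q τ involutive x ⟨
      B.P τ (B.P τ x)     ≡⟨ P≈P′ (B.P-bounded τ x<n) ⟩
      B′.P τ′ (B.P τ x)   ≡⟨ cong (B′.P τ′) (P≈P′ x<n) ⟩
      B′.P τ′ (B′.P τ′ x) ≡⟨ B′.P∘P≗Q τ′ involutive′ x ⟩
      B′.Q x              ∎
    supports-agree : a ≡ a′ × s ≡ s′
    supports-agree = support-unique B.Q-support B′.Q-support B.0<s B′.0<s
                       (Shape.fits shape) (Shape.fits shape′) Q≈Q′
    a≡a′ : a ≡ a′
    a≡a′ = proj₁ supports-agree
    s≡s′ : s ≡ s′
    s≡s′ = proj₂ supports-agree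
    t≡t′ : t ≡ t′
    t≡t′ = +-cancelˡ-≡ a t t′ (begin
      a + t         ≡⟨ B.P-start τ ⟨
      B.P τ a       ≡⟨ P≈P′ (<-≤-trans (m<m+n a B.0<s) (Shape.fits shape)) ⟩
      B′.P τ′ a     ≡⟨ cong (B′.P τ′) a≡a′ ⟩
      B′.P τ′ a′    ≡⟨ B′.P-start τ′ ⟩
      a′ + t′       ≡⟨ cong (_+ t′) a≡a′ ⟨
      a + t′        ∎)

involutions : (m : ℕ) → List (Fin m → Fin m)
involutions m = filter (T? ∘ isInvolutionB) (allFuns m m)

permsOfShape : (n s : ℕ) .{{_ : NonZero s}} (a t : ℕ) → List (Fin n → Fin n)
permsOfShape n s a t = map (perm n s a t) (involutions (n ∸ s))

permsOfStart : (n s : ℕ) .{{_ : NonZero s}} (a : ℕ) → List (Fin n → Fin n)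
permsOfStart n s a = concatMap (permsOfShape n s a) (applyUpTo suc (ℕ.pred s))

permsOfLength : (n s : ℕ) .{{_ : NonZero s}} → List (Fin n → Fin n)
permsOfLength n s = concatMap (permsOfStart n s) (upTo (suc (n ∸ s)))

candidates : (n K : ℕ) → List (Fin n → Fin n)
candidates n K = concatMap (λ i → permsOfLength n (2 * suc i + 1)) (upTo K)

record HasShape (n s a t : ℕ) .{{_ : NonZero s}} (f : Fin n → Fin n) : Set where
  field
    shape      : Shape n s a t
    τ          : Fin (n ∸ s) → Fin (n ∸ s)
    involutive : ∀ i → τ (τ i) ≡ i
    f≗perm     : f ≗ perm n s a t τ

module _ {n : ℕ} where
  open Membershipₛ (≗-setoid n n) using (_∈_)

  hasShape-good : ∀ {s a t f} .{{_ : NonZero s}} → HasShape n s a t f →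
    T (isInjectiveB f ∧ ⌊ descents (λ i → f (f i)) ℕ.≟ 1 ⌋)
  hasShape-good shaped = perm-good shape involutive f≗perm
    where open HasShape shaped

  hasShape-unique : ∀ {s a t s′ a′ t′ f} .{{_ : NonZero s}} .{{_ : NonZero s′}} →
    HasShape n s a t f → HasShape n s′ a′ t′ f → s ≡ s′ × a ≡ a′ × t ≡ t′
  hasShape-unique shaped shaped′ = perm-shape-injective S.shape S′.shape S.involutive S′.involutive
    (λ i → trans (sym (S.f≗perm i)) (S′.f≗perm i))
    where
    module S  = HasShape shaped
    module S′ = HasShape shaped′

  ∈-permsOfShape⁻ : ∀ {s a t f} .{{_ : NonZero s}} → Shape n s a t → f ∈ permsOfShape n s a t → HasShape n s a t f
  ∈-permsOfShape⁻ shape f∈ with ∈ₛ.∈-map⁻ (setoid _) (≗-setoid n n) f∈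
  ... | τ , τ∈ , f≗perm = record
    { shape      = shape
    ; τ          = τ
    ; involutive = T-isInvolutionB⁻ τ (proj₂ (∈ₚ.∈-filter⁻ (T? ∘ isInvolutionB) {xs = allFuns _ _} τ∈))
    ; f≗perm     = f≗perm
    }

  permsOfShape-unique : ∀ {s a t} .{{_ : NonZero s}} → Shape n s a t → Unique (≗-setoid n n) (permsOfShape n s a t)
  permsOfShape-unique {s} shape = Uniqueₛ.map⁺ (≗-setoid (n ∸ s) (n ∸ s)) (≗-setoid n n) (perm-injective shape)
    (Uniqueₛ.filter⁺ (≗-setoid (n ∸ s) (n ∸ s)) (T? ∘ isInvolutionB) (allFuns-unique (n ∸ s) (n ∸ s)))

  length-permsOfShape : ∀ {s a t} .{{_ : NonZero s}} → length (permsOfShape n s a t) ≡ e (n ∸ s)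
  length-permsOfShape {s} {a} {t} = trans (length-map (perm n s a t) (involutions (n ∸ s)))
    (sym (countB≡length-filter isInvolutionB (allFuns (n ∸ s) (n ∸ s))))

  length-permsOfLength : ∀ {s} .{{_ : NonZero s}} →
    length (permsOfLength n s) ≡ suc (n ∸ s) * (ℕ.pred s * e (n ∸ s))
  length-permsOfLength {s} = length-concatMap-applyUpTo {F = permsOfStart n s} id (suc (n ∸ s))
    λ {a} _ → length-concatMap-applyUpTo {F = permsOfShape n s a} suc (ℕ.pred s)
      λ {t} _ → length-permsOfShape {a = a} {t = suc t}

  n∸1≤[1+n∸s]*pred[s] : ∀ {s} → s ≤ n → 1 < s → n ∸ 1 ≤ suc (n ∸ s) * ℕ.pred s
  n∸1≤[1+n∸s]*pred[s] {suc (suc r)} s≤n (s≤s (s≤s z≤n)) = begin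
    n ∸ 1                 ≡⟨ cong (_∸ 1) (m∸n+n≡m s≤n) ⟨
    d + suc (suc r) ∸ 1   ≡⟨ cong (_∸ 1) (+-suc d (suc r)) ⟩
    d + suc r             ≡⟨ +-comm d (suc r) ⟩
    suc r + d             ≤⟨ +-monoʳ-≤ (suc r) (m≤m*n d (suc r)) ⟩
    suc r + d * suc r     ∎
    where
    open ≤-Reasoning
    d : ℕ
    d = n ∸ suc (suc r)

  permsOfLength-lower-bound : ∀ {s} .{{_ : NonZero s}} → s ≤ n → 1 < s →
    (n ∸ 1) * e (n ∸ s) ≤ length (permsOfLength n s)
  permsOfLength-lower-bound {s} s≤n 1<s = begin
    (n ∸ 1) * e (n ∸ s)                       ≤⟨ *-monoˡ-≤ (e (n ∸ s)) (n∸1≤[1+n∸s]*pred[s] s≤n 1<s) ⟩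
    suc (n ∸ s) * ℕ.pred s * e (n ∸ s)        ≡⟨ *-assoc (suc (n ∸ s)) (ℕ.pred s) (e (n ∸ s)) ⟩
    suc (n ∸ s) * (ℕ.pred s * e (n ∸ s))      ≡⟨ length-permsOfLength ⟨
    length (permsOfLength n s)                ∎
    where open ≤-Reasoning

  module _ {s : ℕ} .{{_ : NonZero s}} (s≤n : s ≤ n) (odd : ∀ t → t + t ≢ s) where

    shape-at : ∀ {a t} → a < suc (n ∸ s) → t < ℕ.pred s → Shape n s a (suc t)
    shape-at {a} {t} a<1+n∸s t<pred-s = record
      { fits  = subst (a + s ≤_) (m∸n+n≡m s≤n) (+-monoˡ-≤ s (ℕ.s≤s⁻¹ a<1+n∸s))
      ; 0<t   = z<s
      ; t<s   = subst (suc t <_) (suc-pred s) (s<s t<pred-s)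
      ; t+t≢s = odd (suc t)
      }

    ∈-permsOfStart⁻ : ∀ {a f} → a < suc (n ∸ s) → f ∈ permsOfStart n s a → ∃[ t ] HasShape n s a t f
    ∈-permsOfStart⁻ a<1+n∸s f∈ with ∈-concatMap-applyUpTo⁻ (≗-setoid n n) suc f∈
    ... | t , t<pred-s , f∈′ = suc t , ∈-permsOfShape⁻ (shape-at a<1+n∸s t<pred-s) f∈′

    ∈-permsOfLength⁻ : ∀ {f} → f ∈ permsOfLength n s → ∃[ a ] ∃[ t ] HasShape n s a t f
    ∈-permsOfLength⁻ f∈ with ∈-concatMap-applyUpTo⁻ (≗-setoid n n) id f∈
    ... | a , a<1+n∸s , f∈′ = a , ∈-permsOfStart⁻ a<1+n∸s f∈′

    permsOfStart-unique : ∀ {a} → a < suc (n ∸ s) → Unique (≗-setoid n n) (permsOfStart n s a)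
    permsOfStart-unique a<1+n∸s = unique-concatMap-applyUpTo (≗-setoid n n) suc (ℕ.pred s)
      (λ t<pred-s → permsOfShape-unique (shape-at a<1+n∸s t<pred-s))
      λ t<t′ t′<pred-s (f∈ , f∈′) →
        let shaped  = ∈-permsOfShape⁻ (shape-at a<1+n∸s (<-trans t<t′ t′<pred-s)) f∈
            shaped′ = ∈-permsOfShape⁻ (shape-at a<1+n∸s t′<pred-s) f∈′
        in <⇒≢ t<t′ (suc-injective (proj₂ (proj₂ (hasShape-unique shaped shaped′))))

    permsOfLength-unique : Unique (≗-setoid n n) (permsOfLength n s)
    permsOfLength-unique = unique-concatMap-applyUpTo (≗-setoid n n) id (suc (n ∸ s)) permsOfStart-unique
      λ a<a′ a′<1+n∸s (f∈ , f∈′) →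
        let _ , shaped  = ∈-permsOfStart⁻ (<-trans a<a′ a′<1+n∸s) f∈
            _ , shaped′ = ∈-permsOfStart⁻ a′<1+n∸s f∈′
        in <⇒≢ a<a′ (proj₁ (proj₂ (hasShape-unique shaped shaped′)))

double≢odd : ∀ t i → t + t ≢ 2 * i + 1
double≢odd t i t+t≡2i+1 = even≢odd t i (trans (cong (t +_) (+-identityʳ t)) (trans t+t≡2i+1 (+-comm (2 * i) 1)))

odd-block-fits : ∀ {n i} → i < (n ∸ 1) / 2 → 2 * suc i + 1 ≤ n
odd-block-fits {suc n} {i} i<n/2 = subst (2 * suc i + 1 ≤_) (+-comm n 1) (+-monoˡ-≤ 1 (begin
  2 * suc i     ≤⟨ *-monoʳ-≤ 2 i<n/2 ⟩
  2 * (n / 2)   ≡⟨ *-comm 2 (n / 2) ⟩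
  n / 2 * 2     ≤⟨ m/n*n≤m n 2 ⟩
  n             ∎))
  where open ≤-Reasoning

module _ (n : ℕ) {K : ℕ} (K≤n/2 : K ≤ (n ∸ 1) / 2) where
  open Membershipₛ (≗-setoid n n) using (_∈_)

  private
    fits : ∀ {i} → i < K → 2 * suc i + 1 ≤ n
    fits i<K = odd-block-fits (<-≤-trans i<K K≤n/2)

    odd : ∀ i t → t + t ≢ 2 * suc i + 1
    odd i t = double≢odd t (suc i)

  ∈-candidates⁻ : ∀ {f} → f ∈ candidates n K → ∃[ i ] ∃[ a ] ∃[ t ] HasShape n (2 * suc i + 1) a t f
  ∈-candidates⁻ f∈ with ∈-concatMap-applyUpTo⁻ (≗-setoid n n) id f∈
  ... | i , i<K , f∈′ = i , ∈-permsOfLength⁻ (fits i<K) (odd i) f∈′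

  candidates-unique : Unique (≗-setoid n n) (candidates n K)
  candidates-unique = unique-concatMap-applyUpTo (≗-setoid n n) id K
    (λ {i} i<K → permsOfLength-unique (fits i<K) (odd i))
    λ {i} {j} i<j j<K (f∈ , f∈′) →
      let _ , _ , shaped  = ∈-permsOfLength⁻ (fits (<-trans i<j j<K)) (odd i) f∈
          _ , _ , shaped′ = ∈-permsOfLength⁻ (fits j<K) (odd j) f∈′
      in <⇒≢ i<j (block-index-injective (proj₁ (hasShape-unique shaped shaped′)))
    where
    block-index-injective : ∀ {i j} → 2 * suc i + 1 ≡ 2 * suc j + 1 → i ≡ j
    block-index-injective eq = suc-injective (*-cancelˡ-≡ _ _ 2 (+-cancelʳ-≡ 1 _ _ eq))

  length-candidates : (n ∸ 1) * sumFrom1 K (λ i → e (n ∸ (2 * i + 1))) ≤ length (candidates n K)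
  length-candidates = begin
    (n ∸ 1) * sumFrom1 K (λ i → e (n ∸ (2 * i + 1)))   ≡⟨ *-sumFrom1 (n ∸ 1) K _ ⟩
    sumFrom1 K (λ i → (n ∸ 1) * e (n ∸ (2 * i + 1)))   ≤⟨ sumFrom1≤length-concatMap-upTo K _ blocks-large ⟩
    length (candidates n K)                            ∎
    where
    open ≤-Reasoning
    blocks-large : ∀ {i} → i < K → (n ∸ 1) * e (n ∸ (2 * suc i + 1)) ≤ length (permsOfLength n (2 * suc i + 1))
    blocks-large i<K = permsOfLength-lower-bound (fits i<K) (s≤s (m≤n+m 1 _))

corollary4p5 : (n : ℕ) → 2 ≤ n →
    (n ∸ 1) * sumFrom1 ((n ∸ 1) / 2) (λ i → e (n ∸ (2 * i + 1))) ≤ countOneDescentSquares n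
corollary4p5 n _ = begin
  (n ∸ 1) * sumFrom1 K (λ i → e (n ∸ (2 * i + 1))) ≤⟨ length-candidates n ≤-refl ⟩
  length (candidates n K)                          ≤⟨ countB-lower-bound square-has-one-descent
                                                        (candidates-unique n ≤-refl) good ⟩
  countB square-has-one-descent (allFuns n n)      ∎
  where
  open ≤-Reasoning
  K : ℕ
  K = (n ∸ 1) / 2
  square-has-one-descent : (Fin n → Fin n) → Bool
  square-has-one-descent π = isInjectiveB π ∧ ⌊ descents (λ i → π (π i)) ℕ.≟ 1 ⌋
  good : ∀ {f} → Membershipₛ._∈_ (≗-setoid n n) f (candidates n K) → T (square-has-one-descent f)
  good f∈ = let _ , _ , _ , shaped = ∈-candidates⁻ n ≤-refl f∈ in hasShape-good shaped
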